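{- For all $n\ge0$ and $q\ge1$, listing the set $\mathcal{W}^q_n$ of $q$-decreasing binary words of length $n$ in the order in which they appear in the binary reflected Gray code list $G_n$ yields a 3-Gray code for $\mathcal{W}^q_n$, i.e. any two consecutive words in this list differ in at most $3$ positions.
   Context: A binary word is $q$-decreasing ($q\ge1$) if each of its maximal factors (maximal blocks of consecutive letters) of the form $0^a1^b$ with $a>0$ satisfies $q\cdot a>b$. The binary reflected Gray code list is defined by $G_0=(\epsilon)$ (the empty word) and $G_n=0\cdot G_{n-1}\circ 1\cdot \overline{G_{n-1}}$, where $u\cdot L$ prefixes $u$ to every word of the list $L$, $\circ$ is concatenation of lists and $\overline{L}$ is the reverse of the list $L$. A $k$-Gray code for a set $\mathcal{A}$ of words of equal length is an ordered list of the elements of $\mathcal{A}$, each exactly once, in which consecutive words have Hamming distance at most $k$. -}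

module Defs where

open import Data.Bool using (Bool; true; false; not; if_then_else_)
open import Data.Nat using (ℕ; zero; suc; _+_; _*_; _<_; _≤_; _<ᵇ_)
open import Data.List using (List; []; _∷_; map; _++_; reverse; filter)
open import Data.Product using (_×_; _,_)
open import Relation.Nullary using (Dec; yes; no)
open import Relation.Nullary.Decidable using (does)
open import Relation.Unary using (Pred; Decidable)
open import Level using (0ℓ)
open import Data.Unit using (⊤)
open import Data.Empty using (⊥)

-- Binary words: false = letter 0, true = letter 1.
Word : Set
Word = List Bool

runs : Word → List (Bool × ℕ)
runs [] = []
runs (x ∷ w) with runs w
... | [] = (x , 1) ∷ []
... | (y , k) ∷ rs = if does (Data.Bool._≟_ x y)
                       then (y , suc k) ∷ rs
                       else (x , 1) ∷ (y , k) ∷ rs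

-- Check, on the run list, that every maximal factor 0^a 1^b (a > 0)
-- satisfies q * a > b.  A 0-run of length a is followed either by a
-- 1-run of length b, or by nothing (then b = 0).
qdecRuns : ℕ → List (Bool × ℕ) → Bool
qdecRuns q [] = true
qdecRuns q ((false , a) ∷ []) = 0 <ᵇ (q * a)
qdecRuns q ((false , a) ∷ (true , b) ∷ rs) = (b <ᵇ (q * a)) Data.Bool.∧ qdecRuns q rs
qdecRuns q ((false , a) ∷ (false , b) ∷ rs) = qdecRuns q ((false , b) ∷ rs) -- impossible for run lists
qdecRuns q ((true , b) ∷ rs) = qdecRuns q rs

qDecreasingᵇ : ℕ → Word → Bool
qDecreasingᵇ q w = qdecRuns q (runs w)

QDecreasing : ℕ → Pred Word 0ℓ
QDecreasing q w = qDecreasingᵇ q w ≡ true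
  where open import Relation.Binary.PropositionalEquality using (_≡_)

qDecreasing? : (q : ℕ) → Decidable (QDecreasing q)
qDecreasing? q w = Data.Bool._≟_ (qDecreasingᵇ q w) true

G : ℕ → List Word
G zero = [] ∷ []
G (suc n) = map (false ∷_) (G n) ++ map (true ∷_) (reverse (G n))

-- Hamming distance (words of equal length; extra letters counted as differences)
hamming : Word → Word → ℕ
hamming [] [] = 0
hamming [] (_ ∷ v) = suc (hamming [] v)
hamming (_ ∷ u) [] = suc (hamming u [])
hamming (x ∷ u) (y ∷ v) = (if does (Data.Bool._≟_ x y) then 0 else 1) + hamming u v

data Chain {A : Set} (R : A → A → Set) : List A → Set where
  []   : Chain R []
  [-]  : ∀ x → Chain R (x ∷ [])
  _∷_  : ∀ {x y ys} → R x y → Chain R (y ∷ ys) → Chain R (x ∷ y ∷ ys)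

W-in-Gray-order : ℕ → ℕ → List Word
W-in-Gray-order q n = filter (qDecreasing? q) (G n)

-- Since G (n+1) is 0·G n followed by 1·reverse (G n), the words of a set W listed in Gray order are
-- 0·(the residual {w ∣ 0w ∈ W} in Gray order) followed by 1·(the residual {w ∣ 1w ∈ W} in reverse
-- Gray order).  Suppose W is closed under turning any suffix into zeros.  The q-decreasing words are,
-- for q ≥ 1: a factor 0^a 1^b becomes 0^a 1^b′ with b′ ≤ b, followed by zeros only, and a lone block
-- 0^c satisfies q·c > 0.  Then so are all residuals, every such sublist starts with 0^n, and by
-- induction it ends with a word having at most one 1.  At the seam of the two halves the last words of
-- the two residual sublists meet: they differ in at most 2 positions, plus the first letter.

module Submission where

open import Defs
open import Data.Bool using (Bool; true; false; if_then_else_)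
open import Data.Bool.Properties using (∧-identityʳ)
import Data.Bool as Bool
open import Data.List using (List; []; _∷_; [_]; _++_; _∷ʳ_; map; reverse; filter; foldl; length; replicate; head; last)
open import Data.List.Properties
  using (filter-++; filter-none; unfold-reverse; reverse-involutive; ++-identityʳ; head-map; last-map; foldl-++)
open import Data.List.Relation.Unary.All as All using (All; []; _∷_)
open import Data.List.Relation.Unary.All.Properties using (++⁺; map⁺)
open import Data.List.Relation.Unary.Linked as Linked using (Linked; []; [-]; _∷_)
import Data.List.Relation.Unary.Linked.Properties as Linked
open import Data.List.Relation.Binary.Permutation.Propositional using (↭-sym)
open import Data.List.Relation.Binary.Permutation.Propositional.Properties using (All-resp-↭; ↭-reverse)
open import Data.Maybe using (Maybe; just; nothing)
import Data.Maybe as Maybe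
open import Data.Maybe.Relation.Unary.All as MaybeAll using (just; nothing)
import Data.Maybe.Relation.Unary.All.Properties as MaybeAll
open import Data.Maybe.Relation.Binary.Connected
  using (Connected; just; just-nothing; nothing-just; nothing)
open import Data.Nat using (ℕ; zero; suc; _+_; _*_; _≤_; _≥_; _<ᵇ_; z≤n; s≤s)
open import Data.Nat.Properties using (+-suc; +-comm; ≤-reflexive; ≤-trans)
open import Data.Product using (∃; _×_; _,_; proj₁; proj₂)
open import Function using (_∘_)
open import Level using (Level; 0ℓ)
open import Relation.Binary.PropositionalEquality
  using (_≡_; refl; sym; trans; cong; cong₂; subst; subst₂; module ≡-Reasoning)
open import Relation.Nullary using (yes; no; does)
open import Relation.Unary using (Pred; Decidable)

private
  variable
    a p r : Level
    A : Set a

module _ {A : Set} {R : A → A → Set} where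

  Linked⇒Chain : ∀ {xs} → Linked R xs → Chain R xs
  Linked⇒Chain [] = []
  Linked⇒Chain {x ∷ []} [-] = [-] x
  Linked⇒Chain (r ∷ l) = r ∷ Linked⇒Chain l

last-∷ʳ : (xs : List A) (x : A) → last (xs ∷ʳ x) ≡ just x
last-∷ʳ [] x = refl
last-∷ʳ (y ∷ []) x = refl
last-∷ʳ (y ∷ z ∷ zs) x = last-∷ʳ (z ∷ zs) x

last-reverse : (xs : List A) → last (reverse xs) ≡ head xs
last-reverse [] = refl
last-reverse (x ∷ xs) = trans (cong last (unfold-reverse x xs)) (last-∷ʳ (reverse xs) x)

head-reverse : (xs : List A) → head (reverse xs) ≡ last xs
head-reverse xs = begin
  head (reverse xs)                   ≡⟨ sym (last-reverse (reverse xs)) ⟩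
  last (reverse (reverse xs))         ≡⟨ cong last (reverse-involutive xs) ⟩
  last xs                             ∎
  where open ≡-Reasoning

last-++⁺ : {P : Pred A p} (xs ys : List A) →
           MaybeAll.All P (last xs) → MaybeAll.All P (last ys) → MaybeAll.All P (last (xs ++ ys))
last-++⁺ [] ys _ pys = pys
last-++⁺ (x ∷ []) [] pxs _ = pxs
last-++⁺ (x ∷ []) (y ∷ ys) _ pys = pys
last-++⁺ (x ∷ x′ ∷ xs) ys pxs pys = last-++⁺ (x′ ∷ xs) ys pxs pys

All-reverse⁺ : {P : Pred A p} {xs : List A} → All P xs → All P (reverse xs)
All-reverse⁺ {xs = xs} = All-resp-↭ (↭-sym (↭-reverse xs))

module _ {R : A → A → Set r} where

  Linked-reverse⁺ : (∀ x y → R x y → R y x) → ∀ {xs} → Linked R xs → Linked R (reverse xs)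
  Linked-reverse⁺ R-sym [] = []
  Linked-reverse⁺ R-sym [-] = [-]
  Linked-reverse⁺ R-sym (_∷_ {x} {y} {ys} Rxy l) =
    subst (Linked R) (sym (unfold-reverse x (y ∷ ys)))
      (Linked.++⁺ (Linked-reverse⁺ R-sym l) junction [-])
    where
      junction : Connected R (last (reverse (y ∷ ys))) (just x)
      junction = subst (λ m → Connected R m (just x)) (sym (last-reverse (y ∷ ys))) (just (R-sym x y Rxy))

  Connected-map⁺ : {P Q : Pred A p} {f g : A → A} {mx my : Maybe A} →
                   (∀ {x y} → P x → Q y → R (f x) (g y)) →
                   MaybeAll.All P mx → MaybeAll.All Q my → Connected R (Maybe.map f mx) (Maybe.map g my)
  Connected-map⁺ k (just px) (just qy) = just (k px qy)
  Connected-map⁺ k (just _) nothing = just-nothing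
  Connected-map⁺ k nothing (just _) = nothing-just
  Connected-map⁺ k nothing nothing = nothing

module _ {P : Pred A p} (P? : Decidable P) where

  filter-map : {B : Set a} (f : B → A) (xs : List B) →
               filter P? (map f xs) ≡ map f (filter (P? ∘ f) xs)
  filter-map f [] = refl
  filter-map f (x ∷ xs) with does (P? (f x))
  ... | true = cong (f x ∷_) (filter-map f xs)
  ... | false = filter-map f xs

  filter-reverse : (xs : List A) → filter P? (reverse xs) ≡ reverse (filter P? xs)
  filter-reverse [] = refl
  filter-reverse (x ∷ xs) = begin
    filter P? (reverse (x ∷ xs))              ≡⟨ cong (filter P?) (unfold-reverse x xs) ⟩
    filter P? (reverse xs ++ [ x ])           ≡⟨ filter-++ P? (reverse xs) [ x ] ⟩
    filter P? (reverse xs) ++ filter P? [ x ] ≡⟨ cong (_++ filter P? [ x ]) (filter-reverse xs) ⟩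
    reverse (filter P? xs) ++ filter P? [ x ] ≡⟨ snoc-filter ⟩
    reverse (filter P? (x ∷ xs))              ∎
    where
      open ≡-Reasoning
      snoc-filter : reverse (filter P? xs) ++ filter P? [ x ] ≡ reverse (filter P? (x ∷ xs))
      snoc-filter with does (P? x)
      ... | true = sym (unfold-reverse x (filter P? xs))
      ... | false = ++-identityʳ _

  head-filter-∷ : ∀ {x} xs → All (λ y → P y → P x) xs → MaybeAll.All (_≡ x) (head (filter P? (x ∷ xs)))
  head-filter-∷ {x} xs below with P? x
  ... | yes _ = just refl
  ... | no ¬px rewrite filter-none P? (All.map (¬px ∘_) below) = nothing

zeros : ℕ → Word
zeros m = replicate m false

Near : ℕ → Word → Word → Set
Near k u v = hamming u v ≤ k

hamming-sym : (u v : Word) → hamming u v ≡ hamming v u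
hamming-sym [] [] = refl
hamming-sym [] (_ ∷ v) = cong suc (hamming-sym [] v)
hamming-sym (_ ∷ u) [] = cong suc (hamming-sym u [])
hamming-sym (true ∷ u) (true ∷ v) = hamming-sym u v
hamming-sym (true ∷ u) (false ∷ v) = cong suc (hamming-sym u v)
hamming-sym (false ∷ u) (true ∷ v) = cong suc (hamming-sym u v)
hamming-sym (false ∷ u) (false ∷ v) = hamming-sym u v

hamming-self : (u : Word) → hamming u u ≡ 0
hamming-self [] = refl
hamming-self (true ∷ u) = hamming-self u
hamming-self (false ∷ u) = hamming-self u

Near-sym : ∀ {k} u v → Near k u v → Near k v u
Near-sym {k} u v = subst (_≤ k) (hamming-sym u v)

Near-∷ : ∀ {k u v} b → Near k u v → Near k (b ∷ u) (b ∷ v)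
Near-∷ true d = d
Near-∷ false d = d

data Weight≤1 : ℕ → Word → Set where
  []         : Weight≤1 0 []
  false∷_    : ∀ {m w} → Weight≤1 m w → Weight≤1 (suc m) (false ∷ w)
  true∷zeros : ∀ {m} → Weight≤1 (suc m) (true ∷ zeros m)

Weight≤1-near-zeros : ∀ {m w} → Weight≤1 m w → Near 1 w (zeros m)
Weight≤1-near-zeros [] = z≤n
Weight≤1-near-zeros (false∷ w) = Weight≤1-near-zeros w
Weight≤1-near-zeros (true∷zeros {m}) = s≤s (≤-reflexive (hamming-self (zeros m)))

Weight≤1-near : ∀ {m u v} → Weight≤1 m u → Weight≤1 m v → Near 2 u v
Weight≤1-near [] [] = z≤n
Weight≤1-near (false∷ u) (false∷ v) = Weight≤1-near u v
Weight≤1-near (false∷ u) true∷zeros = s≤s (Weight≤1-near-zeros u)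
Weight≤1-near (true∷zeros {m}) (false∷_ {w = v} v≤1) = s≤s (Near-sym v (zeros m) (Weight≤1-near-zeros v≤1))
Weight≤1-near (true∷zeros {m}) true∷zeros = ≤-trans (≤-reflexive (hamming-self (zeros m))) z≤n

G-head : ∀ m → ∃ λ t → G m ≡ zeros m ∷ t
G-head zero = [] , refl
G-head (suc m) with G-head m
... | t , eq rewrite eq = _ , refl

G-length : ∀ m → All (λ w → length w ≡ m) (G m)
G-length zero = refl ∷ []
G-length (suc m) = ++⁺ (map⁺ shifted) (map⁺ (All-reverse⁺ shifted))
  where
    shifted : All (λ w → suc (length w) ≡ suc m) (G m)
    shifted = All.map (cong suc) (G-length m)

Linked-∷⁺ : ∀ {k} b {ws} → Linked (Near k) ws → Linked (Near k) (map (b ∷_) ws)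
Linked-∷⁺ b = Linked.map⁺ ∘ Linked.map (λ {u} {v} → Near-∷ {u = u} {v = v} b)

ZeroSuffixClosed : Pred Word p → Set p
ZeroSuffixClosed P = ∀ u w → P (u ++ w) → P (u ++ zeros (length w))

module _ {P : Pred Word p} (P? : Decidable P) where

  head-filter-G : ZeroSuffixClosed P → ∀ m → MaybeAll.All (_≡ zeros m) (head (filter P? (G m)))
  head-filter-G closed m with G-head m
  ... | t , eq rewrite eq = head-filter-∷ P? t (All.map below lengths)
    where
      lengths : All (λ w → length w ≡ m) t
      lengths = All.tail (subst (All (λ w → length w ≡ m)) eq (G-length m))
      below : ∀ {w} → length w ≡ m → P w → P (zeros m)
      below {w} refl = closed [] w

  filter-G-suc : ∀ m → filter P? (G (suc m)) ≡
                 map (false ∷_) (filter (P? ∘ (false ∷_)) (G m)) ++ map (true ∷_) (reverse (filter (P? ∘ (true ∷_)) (G m)))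
  filter-G-suc m = begin
    filter P? (map (false ∷_) (G m) ++ map (true ∷_) (reverse (G m)))
      ≡⟨ filter-++ P? (map (false ∷_) (G m)) _ ⟩
    filter P? (map (false ∷_) (G m)) ++ filter P? (map (true ∷_) (reverse (G m)))
      ≡⟨ cong₂ _++_ (filter-map P? (false ∷_) (G m)) (filter-map P? (true ∷_) (reverse (G m))) ⟩
    map (false ∷_) (filter (P? ∘ (false ∷_)) (G m)) ++ map (true ∷_) (filter (P? ∘ (true ∷_)) (reverse (G m)))
      ≡⟨ cong ((map (false ∷_) (filter (P? ∘ (false ∷_)) (G m)) ++_) ∘ map (true ∷_)) (filter-reverse (P? ∘ (true ∷_)) (G m)) ⟩
    map (false ∷_) (filter (P? ∘ (false ∷_)) (G m)) ++ map (true ∷_) (reverse (filter (P? ∘ (true ∷_)) (G m)))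
      ∎
    where open ≡-Reasoning

filter-G-near₃ : {P : Pred Word p} (P? : Decidable P) → ZeroSuffixClosed P → ∀ m →
                Linked (Near 3) (filter P? (G m)) × MaybeAll.All (Weight≤1 m) (last (filter P? (G m)))
filter-G-near₃ P? closed zero with does (P? [])
... | true = [-] , just []
... | false = [] , nothing
filter-G-near₃ P? closed (suc m) rewrite filter-G-suc P? m =
  Linked.++⁺ (Linked-∷⁺ false (proj₁ IH₀)) junction (Linked-∷⁺ true (Linked-reverse⁺ Near-sym (proj₁ IH₁))) ,
  last-++⁺ (map (false ∷_) F₀) (map (true ∷_) (reverse F₁)) end₀ end₁
  where
    F₀ F₁ : List Word
    F₀ = filter (P? ∘ (false ∷_)) (G m)
    F₁ = filter (P? ∘ (true ∷_)) (G m)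
    IH₀ : Linked (Near 3) F₀ × MaybeAll.All (Weight≤1 m) (last F₀)
    IH₀ = filter-G-near₃ (P? ∘ (false ∷_)) (closed ∘ (false ∷_)) m
    IH₁ : Linked (Near 3) F₁ × MaybeAll.All (Weight≤1 m) (last F₁)
    IH₁ = filter-G-near₃ (P? ∘ (true ∷_)) (closed ∘ (true ∷_)) m
    junction : Connected (Near 3) (last (map (false ∷_) F₀)) (head (map (true ∷_) (reverse F₁)))
    junction = subst₂ (Connected (Near 3)) (sym (last-map (false ∷_) F₀)) (sym head₁)
      (Connected-map⁺ (λ u v → s≤s (Weight≤1-near u v)) (proj₂ IH₀) (proj₂ IH₁))
      where
        head₁ : head (map (true ∷_) (reverse F₁)) ≡ Maybe.map (true ∷_) (last F₁)
        head₁ = trans (head-map (reverse F₁)) (cong (Maybe.map (true ∷_)) (head-reverse F₁))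
    end₀ : MaybeAll.All (Weight≤1 (suc m)) (last (map (false ∷_) F₀))
    end₀ = subst (MaybeAll.All _) (sym (last-map (false ∷_) F₀)) (MaybeAll.map⁺ (MaybeAll.map false∷_ (proj₂ IH₀)))
    end₁ : MaybeAll.All (Weight≤1 (suc m)) (last (map (true ∷_) (reverse F₁)))
    end₁ = subst (MaybeAll.All _) (sym last₁)
      (MaybeAll.map⁺ (MaybeAll.map (λ { refl → true∷zeros }) (head-filter-G (P? ∘ (true ∷_)) (closed ∘ (true ∷_)) m)))
      where
        last₁ : last (map (true ∷_) (reverse F₁)) ≡ Maybe.map (true ∷_) (head F₁)
        last₁ = trans (last-map (true ∷_) (reverse F₁)) (cong (Maybe.map (true ∷_)) (last-reverse F₁))

module Automaton {S : Set} (δ : S → Bool → S) (accepting : S → Bool) where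

  Accepts : S → Pred Word 0ℓ
  Accepts s w = accepting (foldl δ s w) ≡ true

  Accepts-++ : ∀ s u w → Accepts s (u ++ w) → Accepts (foldl δ s u) w
  Accepts-++ s u w = subst (λ t → accepting t ≡ true) (foldl-++ δ s u w)

  ++-Accepts : ∀ s u w → Accepts (foldl δ s u) w → Accepts s (u ++ w)
  ++-Accepts s u w = subst (λ t → accepting t ≡ true) (sym (foldl-++ δ s u w))

  module _ (zero-step : ∀ s k → Accepts (δ s true) (zeros k) → Accepts (δ s false) (zeros k)) where

    Accepts-zeros : ∀ s w → Accepts s w → Accepts s (zeros (length w))
    Accepts-zeros s [] acc = acc
    Accepts-zeros s (false ∷ w) acc = Accepts-zeros (δ s false) w acc
    Accepts-zeros s (true ∷ w) acc = zero-step s (length w) (Accepts-zeros (δ s true) w acc)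

    Accepts-zeroSuffixClosed : ∀ s → ZeroSuffixClosed (Accepts s)
    Accepts-zeroSuffixClosed s u w =
      ++-Accepts s u _ ∘ Accepts-zeros (foldl δ s u) w ∘ Accepts-++ s u w

-- The state remembers the factor 0^a 1^b currently being read; the factor is checked when it ends.
data ScanState : Set where
  outside : ScanState
  in0     : ℕ → ScanState
  in01    : ℕ → ℕ → ScanState
  dead    : ScanState

addRun : Bool → ℕ → List (Bool × ℕ) → List (Bool × ℕ)
addRun b n [] = (b , n) ∷ []
addRun b n ((c , k) ∷ rs) = if does (b Bool.≟ c) then (c , n + k) ∷ rs else (b , n) ∷ (c , k) ∷ rs

runs-∷ : ∀ x w → runs (x ∷ w) ≡ addRun x 1 (runs w)
runs-∷ x w with runs w
... | [] = refl
... | (y , k) ∷ rs = refl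

addRun-merge : ∀ b a rs → addRun b a (addRun b 1 rs) ≡ addRun b (suc a) rs
addRun-merge true a [] = cong (λ n → (true , n) ∷ []) (+-comm a 1)
addRun-merge false a [] = cong (λ n → (false , n) ∷ []) (+-comm a 1)
addRun-merge true a ((true , k) ∷ rs) = cong (λ n → (true , n) ∷ rs) (+-suc a k)
addRun-merge false a ((false , k) ∷ rs) = cong (λ n → (false , n) ∷ rs) (+-suc a k)
addRun-merge true a ((false , k) ∷ rs) = cong (λ n → (true , n) ∷ (false , k) ∷ rs) (+-comm a 1)
addRun-merge false a ((true , k) ∷ rs) = cong (λ n → (false , n) ∷ (true , k) ∷ rs) (+-comm a 1)

addRun-switch : ∀ b a rs → addRun b a (addRun (Bool.not b) 1 rs) ≡ (b , a) ∷ addRun (Bool.not b) 1 rs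
addRun-switch true a [] = refl
addRun-switch false a [] = refl
addRun-switch true a ((true , k) ∷ rs) = refl
addRun-switch false a ((true , k) ∷ rs) = refl
addRun-switch true a ((false , k) ∷ rs) = refl
addRun-switch false a ((false , k) ∷ rs) = refl

module QDecreasingAutomaton (q : ℕ) where

  scan : ScanState → Bool → ScanState
  scan outside true = outside
  scan outside false = in0 1
  scan (in0 a) false = in0 (suc a)
  scan (in0 a) true = in01 a 1
  scan (in01 a b) true = in01 a (suc b)
  scan (in01 a b) false = if b <ᵇ q * a then in0 1 else dead
  scan dead _ = dead

  accepting : ScanState → Bool
  accepting outside = true
  accepting (in0 a) = 0 <ᵇ q * a
  accepting (in01 a b) = b <ᵇ q * a
  accepting dead = false

  open Automaton scan accepting public

  dead-rejects : ∀ w → accepting (foldl scan dead w) ≡ false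
  dead-rejects [] = refl
  dead-rejects (_ ∷ w) = dead-rejects w

  qdecRuns-addRun-true : ∀ b rs → qdecRuns q (addRun true b rs) ≡ qdecRuns q rs
  qdecRuns-addRun-true b [] = refl
  qdecRuns-addRun-true b ((true , k) ∷ rs) = refl
  qdecRuns-addRun-true b ((false , k) ∷ rs) = refl

  mutual
    in0-correct : ∀ a w → qdecRuns q (addRun false a (runs w)) ≡ accepting (foldl scan (in0 a) w)
    in0-correct a [] = refl
    in0-correct a (false ∷ w) rewrite runs-∷ false w | addRun-merge false a (runs w) = in0-correct (suc a) w
    in0-correct a (true ∷ w) rewrite runs-∷ true w | addRun-switch false a (runs w) = in01-correct a 1 w

    in01-correct : ∀ a b w → qdecRuns q ((false , a) ∷ addRun true b (runs w)) ≡ accepting (foldl scan (in01 a b) w)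
    in01-correct a b [] = ∧-identityʳ _
    in01-correct a b (true ∷ w) rewrite runs-∷ true w | addRun-merge true b (runs w) = in01-correct a (suc b) w
    in01-correct a b (false ∷ w) rewrite runs-∷ false w | addRun-switch true b (runs w) | in0-correct 1 w
      with b <ᵇ q * a
    ... | true = refl
    ... | false = sym (dead-rejects w)

  qDecreasingᵇ-correct : ∀ w → qDecreasingᵇ q w ≡ accepting (foldl scan outside w)
  qDecreasingᵇ-correct [] = refl
  qDecreasingᵇ-correct (true ∷ w) rewrite runs-∷ true w | qdecRuns-addRun-true 1 (runs w) = qDecreasingᵇ-correct w
  qDecreasingᵇ-correct (false ∷ w) rewrite runs-∷ false w = in0-correct 1 w

<ᵇ-pred : ∀ b n → (suc b <ᵇ n) ≡ true → (b <ᵇ n) ≡ true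
<ᵇ-pred b zero ()
<ᵇ-pred zero (suc n) _ = refl
<ᵇ-pred (suc b) (suc n) lt = <ᵇ-pred b n lt

module PositiveQDecreasingAutomaton (q′ : ℕ) where

  open QDecreasingAutomaton (suc q′)

  in0-Accepts-zeros : ∀ a k → Accepts (in0 (suc a)) (zeros k)
  in0-Accepts-zeros a zero = refl
  in0-Accepts-zeros a (suc k) = in0-Accepts-zeros (suc a) k

  in01-Accepts-zeros⇒ : ∀ a b k → Accepts (in01 a b) (zeros k) → (b <ᵇ suc q′ * a) ≡ true
  in01-Accepts-zeros⇒ a b zero acc = acc
  in01-Accepts-zeros⇒ a b (suc k) acc with b <ᵇ suc q′ * a
  ... | true = refl
  ... | false with () ← trans (sym (dead-rejects (zeros k))) acc

  zero-step : ∀ s k → Accepts (scan s true) (zeros k) → Accepts (scan s false) (zeros k)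
  zero-step outside k _ = in0-Accepts-zeros 0 k
  zero-step (in0 a) k _ = in0-Accepts-zeros a k
  zero-step (in01 a b) k acc
    rewrite <ᵇ-pred b (suc q′ * a) (in01-Accepts-zeros⇒ a (suc b) k acc) = in0-Accepts-zeros 0 k
  zero-step dead k acc = acc

QDecreasing-zeroSuffixClosed : ∀ q → q ≥ 1 → ZeroSuffixClosed (QDecreasing q)
QDecreasing-zeroSuffixClosed (suc q′) _ u w dec =
  trans (qDecreasingᵇ-correct (u ++ zeros (length w)))
        (Accepts-zeroSuffixClosed zero-step outside u w (trans (sym (qDecreasingᵇ-correct (u ++ w))) dec))
  where
    open QDecreasingAutomaton (suc q′)
    open PositiveQDecreasingAutomaton q′

corollary6 : (n q : ℕ) → q ≥ 1 → Chain (λ u v → hamming u v ≤ 3) (W-in-Gray-order q n)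
corollary6 n q q≥1 =
  Linked⇒Chain (proj₁ (filter-G-near₃ (qDecreasing? q) (QDecreasing-zeroSuffixClosed q q≥1) n))
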